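{- Let $f:[n]\to[a,b]$ and let $u:[n-1]\to(0,\infty)$, with bounding functions $l=-u$ and $u$; let $u_M=\max_t u(t)$. If $(x,y)$ is a pair violated by $f$, then $f$ violates at least $\min\left\{\frac{vs_f(x,y)}{2u_M},\,n-1\right\}$ unordered pairs of distinct points of $[n]$.
   Context: On $[n]$ with bounding functions $(l,u)$, the quasimetric is $\mathfrak{m}(x,y)=-\sum_{t=x}^{y-1}l(t)$ and $\mathfrak{m}(y,x)=\sum_{t=x}^{y-1}u(t)$ for $x<y$. The violation score is $vs_f(x,y)=\max\{f(x)-f(y)-\mathfrak{m}(x,y),f(y)-f(x)-\mathfrak{m}(y,x)\}$; a pair is violated iff $vs_f(x,y)>0$.
   Formalization: The endpoints a and b are rational, f takes values in $[a,b]$ ∩ ℚ, and u takes values in the positive rationals. -}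

module Defs where

open import Data.Nat as ℕ using (ℕ; zero; suc; _∸_; _<ᵇ_)
open import Data.Integer as ℤ using (+_; +[1+_]; -[1+_])
open import Data.Rational using (ℚ; mkℚ; 0ℚ; _+_; _-_; -_; _*_; _÷_; _⊔_; _/_; _<_)
open import Data.Rational.Properties using (_<?_)
open import Data.List using (List; []; _∷_; foldr; map; applyUpTo; concatMap; upTo; filter; length)
open import Data.Product using (_×_; _,_; proj₁; proj₂)
open import Data.Bool using (if_then_else_)

-- Points of [n] are encoded as the naturals 0,1,…,n-1 (point i+1 of the
-- paper is i here); t ∈ [n-1] indexes the edge between points t and t+1.

ℕ→ℚ : ℕ → ℚ
ℕ→ℚ k = (+ k) / 1

segSum : (ℕ → ℚ) → ℕ → ℕ → ℚ
segSum g x y = foldr _+_ 0ℚ (map g (applyUpTo (x ℕ.+_) (y ∸ x)))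

qm : (l u : ℕ → ℚ) → ℕ → ℕ → ℚ
qm l u x y =
  if x <ᵇ y then - segSum l x y
  else (if y <ᵇ x then segSum u y x else 0ℚ)

vs : (l u : ℕ → ℚ) → (f : ℕ → ℚ) → ℕ → ℕ → ℚ
vs l u f x y = ((f x - f y) - qm l u x y) ⊔ ((f y - f x) - qm l u y x)

-- all unordered pairs {x,y} of distinct points of [n], listed as (x,y), x < y < n
pairs : ℕ → List (ℕ × ℕ)
pairs n = concatMap (λ y → map (λ x → (x , y)) (upTo y)) (upTo n)

countViolated : (l u : ℕ → ℚ) → (f : ℕ → ℚ) → ℕ → ℕ
countViolated l u f n = length (filter (λ p → 0ℚ <? vs l u f (proj₁ p) (proj₂ p)) (pairs n))

maxUpTo : ℕ → (ℕ → ℚ) → ℚ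
maxUpTo zero u = u 0
maxUpTo (suc k) u = maxUpTo k u ⊔ u (suc k)

-- u_M = max_{t ∈ [n-1]} u(t)  (edges 0,…,n-2; only meaningful for n ≥ 2)
uMax : ℕ → (ℕ → ℚ) → ℚ
uMax n u = maxUpTo (n ∸ 2) u

-- p / q, with the (never used here) convention p / 0 = 0
divQ : ℚ → ℚ → ℚ
divQ p q@(mkℚ +[1+ _ ] _ _) = p ÷ q
divQ p q@(mkℚ -[1+ _ ] _ _) = p ÷ q
divQ p (mkℚ (+ 0) _ _) = 0ℚ

{-# OPTIONS --safe #-}
module Submission where

-- With l = -u the quasimetric is the symmetric path length d(x,y) = Σ u over the edges between
-- x and y, so vs(x,y) = |f x - f y| - d(x,y).  The triangle inequality for |f x - f y| gives
-- vs(x,y) ≤ vs(x,z) + vs(z,y) + δ(z), where δ(z) = d(x,z) + d(z,y) - d(x,y) is twice the distance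
-- from z to the segment [x,y].  So every z with δ(z) < vs(x,y) is violated together with x or
-- with y, and a run [L,R] ∋ y of such points yields R - L distinct violated pairs {z, x} or
-- {z, y} (z ≠ y).  If the maximal run around [x,y] is all of [n] this gives n - 1 pairs;
-- otherwise the first point z just outside it, at index distance k from [x,y], has
-- vs(x,y) ≤ δ(z) ≤ 2 k u_M, and the run yields at least k pairs.

open import Defs
open import Data.Empty using (⊥-elim)
open import Data.Fin as Fin using (Fin; toℕ; fromℕ<; punchIn)
import Data.Fin.Properties as Fin
import Data.Integer as ℤ
import Data.Integer.Properties as ℤ
open import Data.List using (List; foldr; map; applyUpTo; upTo; filter; length; lookup)
open import Data.List.Membership.Propositional using (_∈_)
open import Data.List.Membership.Propositional.Properties
  using (∈-filter⁺; ∈-concat⁺′; ∈-map⁺; ∈-upTo⁺)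
open import Data.List.Relation.Unary.Any using (index)
open import Data.List.Relation.Unary.Any.Properties using (lookup-index)
open import Data.Nat as ℕ using (ℕ; zero; suc; _∸_; _<ᵇ_; z≤n; s≤s; z<s)
  renaming (_<_ to _<ℕ_; _≤_ to _≤ℕ_)
import Data.Nat.Coprimality as Coprime
import Data.Nat.Properties as ℕ
open import Data.Product using (_×_; _,_; proj₁; proj₂; ∃-syntax)
open import Data.Rational
  using (ℚ; mkℚ; _/_; 0ℚ; 1ℚ; _+_; _-_; -_; _*_; 1/_; _⊔_; _⊓_; _≤_; _<_; *≤*; *<*)
open import Data.Rational.Properties
open import Algebra.Properties.Group +-0-group using () renaming (⁻¹-involutive to neg-involutive)
open import Data.Rational.Solver using (module +-*-Solver)
open import Data.Sum using (_⊎_; inj₁; inj₂; [_,_]′)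
open import Function.Definitions using (Injective)
open import Relation.Binary.PropositionalEquality
open import Relation.Nullary using (¬_; Dec; yes; no)
open import Relation.Nullary.Reflects using (ofʸ; ofⁿ)
open +-*-Solver

sumFrom : (ℕ → ℚ) → ℕ → ℕ → ℚ
sumFrom g s zero    = 0ℚ
sumFrom g s (suc m) = g s + sumFrom g (suc s) m

foldr-applyUpTo : ∀ g (h : ℕ → ℕ) s m → (∀ k → h k ≡ s ℕ.+ k) →
                  foldr _+_ 0ℚ (map g (applyUpTo h m)) ≡ sumFrom g s m
foldr-applyUpTo g h s zero    h≗s+ = refl
foldr-applyUpTo g h s (suc m) h≗s+ = cong₂ _+_
  (cong g (trans (h≗s+ 0) (ℕ.+-identityʳ s)))
  (foldr-applyUpTo g (λ k → h (suc k)) (suc s) m (λ k → trans (h≗s+ (suc k)) (ℕ.+-suc s k)))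

segSum≡sumFrom : ∀ g i j → segSum g i j ≡ sumFrom g i (j ∸ i)
segSum≡sumFrom g i j = foldr-applyUpTo g (i ℕ.+_) i (j ∸ i) (λ _ → refl)

sumFrom-+ : ∀ g s a b → sumFrom g s (a ℕ.+ b) ≡ sumFrom g s a + sumFrom g (s ℕ.+ a) b
sumFrom-+ g s zero    b = sym (trans (+-identityˡ _) (cong (λ t → sumFrom g t b) (ℕ.+-identityʳ s)))
sumFrom-+ g s (suc a) b = begin
  g s + sumFrom g (suc s) (a ℕ.+ b)
    ≡⟨ cong (g s +_) (sumFrom-+ g (suc s) a b) ⟩
  g s + (sumFrom g (suc s) a + sumFrom g (suc s ℕ.+ a) b)
    ≡⟨ +-assoc (g s) _ _ ⟨
  (g s + sumFrom g (suc s) a) + sumFrom g (suc s ℕ.+ a) b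
    ≡⟨ cong (λ t → (g s + sumFrom g (suc s) a) + sumFrom g t b) (ℕ.+-suc s a) ⟨
  (g s + sumFrom g (suc s) a) + sumFrom g (s ℕ.+ suc a) b ∎
  where open ≡-Reasoning

sumFrom-neg : ∀ g s m → sumFrom (λ t → - g t) s m ≡ - sumFrom g s m
sumFrom-neg g s zero    = refl
sumFrom-neg g s (suc m) = begin
  - g s + sumFrom (λ t → - g t) (suc s) m ≡⟨ cong (- g s +_) (sumFrom-neg g (suc s) m) ⟩
  - g s + - sumFrom g (suc s) m           ≡⟨ neg-distrib-+ (g s) _ ⟨
  - (g s + sumFrom g (suc s) m)           ∎
  where open ≡-Reasoning

coprimeTo1 : ∀ k → Coprime.Coprime k 1
coprimeTo1 k = Coprime.sym (Coprime.1-coprimeTo k)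

ℕ→ℚ≡mkℚ : ∀ k → ℕ→ℚ k ≡ mkℚ (ℤ.+ k) 0 (coprimeTo1 k)
ℕ→ℚ≡mkℚ k = normalize-coprime (coprimeTo1 k)

ℕ→ℚ-suc : ∀ k → ℕ→ℚ (suc k) ≡ 1ℚ + ℕ→ℚ k
ℕ→ℚ-suc k = sym (begin
  1ℚ + ℕ→ℚ k                              ≡⟨ cong (1ℚ +_) (ℕ→ℚ≡mkℚ k) ⟩
  1ℚ + mkℚ (ℤ.+ k) 0 (coprimeTo1 k)       ≡⟨ 1+mkℚ k ⟩
  ℤ.+ suc (k ℕ.* 1) / 1                   ≡⟨ cong (λ m → ℤ.+ suc m / 1) (ℕ.*-identityʳ k) ⟩
  ℕ→ℚ (suc k)                             ∎)
  where
  open ≡-Reasoning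
  1+mkℚ : ∀ m → 1ℚ + mkℚ (ℤ.+ m) 0 (coprimeTo1 m) ≡ ℤ.+ suc (m ℕ.* 1) / 1
  1+mkℚ zero    = refl
  1+mkℚ (suc m) = refl

ℕ→ℚ-mono-≤ : ∀ {j k} → j ≤ℕ k → ℕ→ℚ j ≤ ℕ→ℚ k
ℕ→ℚ-mono-≤ {j} {k} j≤k rewrite ℕ→ℚ≡mkℚ j | ℕ→ℚ≡mkℚ k =
  *≤* (subst₂ ℤ._≤_ (sym (ℤ.*-identityʳ (ℤ.+ j))) (sym (ℤ.*-identityʳ (ℤ.+ k))) (ℤ.+≤+ j≤k))

sumFrom-≤ : ∀ g M s m → (∀ t → s ≤ℕ t → t <ℕ s ℕ.+ m → g t ≤ M) → sumFrom g s m ≤ ℕ→ℚ m * M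
sumFrom-≤ g M s zero    g≤M = ≤-reflexive (sym (*-zeroˡ M))
sumFrom-≤ g M s (suc m) g≤M = begin
  g s + sumFrom g (suc s) m ≤⟨ +-mono-≤ (g≤M s ℕ.≤-refl (ℕ.m<m+n s z<s))
                                         (sumFrom-≤ g M (suc s) m g≤M′) ⟩
  M + ℕ→ℚ m * M             ≡⟨ solve 2 (λ M k → M :+ k :* M := (con 1ℚ :+ k) :* M) refl M (ℕ→ℚ m) ⟩
  (1ℚ + ℕ→ℚ m) * M          ≡⟨ cong (_* M) (ℕ→ℚ-suc m) ⟨
  ℕ→ℚ (suc m) * M           ∎
  where
  open ≤-Reasoning
  g≤M′ : ∀ t → suc s ≤ℕ t → t <ℕ suc s ℕ.+ m → g t ≤ M
  g≤M′ t s<t t<s+m = g≤M t (ℕ.<⇒≤ s<t) (subst (t <ℕ_) (sym (ℕ.+-suc s m)) t<s+m)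

segSum-empty : ∀ g {i j} → j ≤ℕ i → segSum g i j ≡ 0ℚ
segSum-empty g {i} {j} j≤i = trans (segSum≡sumFrom g i j) (cong (sumFrom g i) (ℕ.m≤n⇒m∸n≡0 j≤i))

segSum-split : ∀ g {i j k} → i ≤ℕ j → j ≤ℕ k → segSum g i k ≡ segSum g i j + segSum g j k
segSum-split g {i} {j} {k} i≤j j≤k = begin
  segSum g i k                                           ≡⟨ segSum≡sumFrom g i k ⟩
  sumFrom g i (k ∸ i)                                    ≡⟨ cong (sumFrom g i) k∸i≡ ⟩
  sumFrom g i ((j ∸ i) ℕ.+ (k ∸ j))                      ≡⟨ sumFrom-+ g i (j ∸ i) (k ∸ j) ⟩
  sumFrom g i (j ∸ i) + sumFrom g (i ℕ.+ (j ∸ i)) (k ∸ j)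
    ≡⟨ cong (λ t → sumFrom g i (j ∸ i) + sumFrom g t (k ∸ j)) (ℕ.m+[n∸m]≡n i≤j) ⟩
  sumFrom g i (j ∸ i) + sumFrom g j (k ∸ j)
    ≡⟨ cong₂ _+_ (segSum≡sumFrom g i j) (segSum≡sumFrom g j k) ⟨
  segSum g i j + segSum g j k                            ∎
  where
  open ≡-Reasoning
  k∸i≡ : k ∸ i ≡ (j ∸ i) ℕ.+ (k ∸ j)
  k∸i≡ = begin
    k ∸ i               ≡⟨ cong (_∸ i) (ℕ.m∸n+n≡m j≤k) ⟨
    (k ∸ j) ℕ.+ j ∸ i   ≡⟨ ℕ.+-∸-assoc (k ∸ j) i≤j ⟩
    (k ∸ j) ℕ.+ (j ∸ i) ≡⟨ ℕ.+-comm (k ∸ j) (j ∸ i) ⟩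
    (j ∸ i) ℕ.+ (k ∸ j) ∎

segSum-neg : ∀ g i j → segSum (λ t → - g t) i j ≡ - segSum g i j
segSum-neg g i j = begin
  segSum (λ t → - g t) i j         ≡⟨ segSum≡sumFrom _ i j ⟩
  sumFrom (λ t → - g t) i (j ∸ i)  ≡⟨ sumFrom-neg g i (j ∸ i) ⟩
  - sumFrom g i (j ∸ i)            ≡⟨ cong -_ (segSum≡sumFrom g i j) ⟨
  - segSum g i j                   ∎
  where open ≡-Reasoning

segSum-≤ : ∀ g M {i j} → i ≤ℕ j → (∀ t → i ≤ℕ t → t <ℕ j → g t ≤ M) → segSum g i j ≤ ℕ→ℚ (j ∸ i) * M
segSum-≤ g M {i} {j} i≤j g≤M = subst (_≤ ℕ→ℚ (j ∸ i) * M) (sym (segSum≡sumFrom g i j))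
  (sumFrom-≤ g M i (j ∸ i) (λ t i≤t t<j → g≤M t i≤t (subst (t <ℕ_) (ℕ.m+[n∸m]≡n i≤j) t<j)))

dist : (ℕ → ℚ) → ℕ → ℕ → ℚ
dist u i j = segSum u i j + segSum u j i

dist-sym : ∀ u i j → dist u i j ≡ dist u j i
dist-sym u i j = +-comm (segSum u i j) (segSum u j i)

dist-≤ : ∀ u {i j} → i ≤ℕ j → dist u i j ≡ segSum u i j
dist-≤ u {i} {j} i≤j = trans (cong (segSum u i j +_) (segSum-empty u i≤j)) (+-identityʳ _)

dist-≥ : ∀ u {i j} → j ≤ℕ i → dist u i j ≡ segSum u j i
dist-≥ u {i} {j} j≤i = trans (dist-sym u i j) (dist-≤ u j≤i)

qm-neg≡dist : ∀ u i j → qm (λ t → - u t) u i j ≡ dist u i j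
qm-neg≡dist u i j with i <ᵇ j | ℕ.<ᵇ-reflects-< i j
... | _ | ofʸ i<j = begin
  - segSum (λ t → - u t) i j ≡⟨ cong -_ (segSum-neg u i j) ⟩
  - - segSum u i j           ≡⟨ neg-involutive (segSum u i j) ⟩
  segSum u i j               ≡⟨ dist-≤ u (ℕ.<⇒≤ i<j) ⟨
  dist u i j                 ∎
  where open ≡-Reasoning
... | _ | ofⁿ i≮j with j <ᵇ i | ℕ.<ᵇ-reflects-< j i
...   | _ | ofʸ j<i = sym (dist-≥ u (ℕ.<⇒≤ j<i))
...   | _ | ofⁿ j≮i = sym (trans (dist-≤ u (ℕ.≮⇒≥ j≮i)) (segSum-empty u (ℕ.≮⇒≥ i≮j)))

detour : (ℕ → ℚ) → ℕ → ℕ → ℕ → ℚ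
detour u x y z = (dist u x z + dist u z y) - dist u x y

detour-between : ∀ u {x y z} → x ≤ℕ z → z ≤ℕ y → detour u x y z ≡ 0ℚ
detour-between u {x} {y} {z} x≤z z≤y = begin
  (dist u x z + dist u z y) - dist u x y
    ≡⟨ cong₂ _-_ (cong₂ _+_ (dist-≤ u x≤z) (dist-≤ u z≤y))
                 (trans (dist-≤ u (ℕ.≤-trans x≤z z≤y)) (segSum-split u x≤z z≤y)) ⟩
  (segSum u x z + segSum u z y) - (segSum u x z + segSum u z y)
    ≡⟨ +-inverseʳ (segSum u x z + segSum u z y) ⟩
  0ℚ ∎
  where open ≡-Reasoning

detour-right : ∀ u {x y z} → x ≤ℕ y → y ≤ℕ z → detour u x y z ≡ ℕ→ℚ 2 * segSum u y z
detour-right u {x} {y} {z} x≤y y≤z = begin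
  (dist u x z + dist u z y) - dist u x y
    ≡⟨ cong₂ _-_ (cong₂ _+_ (trans (dist-≤ u (ℕ.≤-trans x≤y y≤z)) (segSum-split u x≤y y≤z))
                            (dist-≥ u y≤z))
                 (dist-≤ u x≤y) ⟩
  ((segSum u x y + segSum u y z) + segSum u y z) - segSum u x y
    ≡⟨ solve 2 (λ a b → ((a :+ b) :+ b) :- a := (con 1ℚ :+ con 1ℚ) :* b) refl
               (segSum u x y) (segSum u y z) ⟩
  ℕ→ℚ 2 * segSum u y z ∎
  where open ≡-Reasoning

detour-left : ∀ u {x y z} → z ≤ℕ x → x ≤ℕ y → detour u x y z ≡ ℕ→ℚ 2 * segSum u z x
detour-left u {x} {y} {z} z≤x x≤y = begin
  (dist u x z + dist u z y) - dist u x y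
    ≡⟨ cong₂ _-_ (cong₂ _+_ (dist-≥ u z≤x)
                            (trans (dist-≤ u (ℕ.≤-trans z≤x x≤y)) (segSum-split u z≤x x≤y)))
                 (dist-≤ u x≤y) ⟩
  (segSum u z x + (segSum u z x + segSum u x y)) - segSum u x y
    ≡⟨ solve 2 (λ a b → (a :+ (a :+ b)) :- b := (con 1ℚ :+ con 1ℚ) :* a) refl
               (segSum u z x) (segSum u x y) ⟩
  ℕ→ℚ 2 * segSum u z x ∎
  where open ≡-Reasoning

vs-sym : ∀ l u f x y → vs l u f x y ≡ vs l u f y x
vs-sym l u f x y = ⊔-comm ((f x - f y) - qm l u x y) ((f y - f x) - qm l u y x)

vs± : (u f : ℕ → ℚ) → ℕ → ℕ → ℚ
vs± u f = vs (λ t → - u t) u f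

vs±≡ : ∀ u f x y → vs± u f x y ≡ ((f x - f y) - dist u x y) ⊔ ((f y - f x) - dist u x y)
vs±≡ u f x y = cong₂ _⊔_ (cong (λ d → (f x - f y) - d) (qm-neg≡dist u x y))
                         (cong (λ d → (f y - f x) - d) (trans (qm-neg≡dist u y x) (dist-sym u y x)))

vs±-refl : ∀ u f x → vs± u f x x ≡ 0ℚ
vs±-refl u f x = begin
  vs± u f x x                                             ≡⟨ vs±≡ u f x x ⟩
  ((f x - f x) - dist u x x) ⊔ ((f x - f x) - dist u x x) ≡⟨ ⊔-idem ((f x - f x) - dist u x x) ⟩
  (f x - f x) - dist u x x                                ≡⟨ cong₂ _-_ (+-inverseʳ (f x)) dist-refl ⟩
  0ℚ - 0ℚ                                                 ≡⟨⟩
  0ℚ                                                      ∎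
  where
  open ≡-Reasoning
  dist-refl : dist u x x ≡ 0ℚ
  dist-refl = trans (dist-≤ u (ℕ.≤-refl {x})) (segSum-empty u (ℕ.≤-refl {x}))

vs±-triangle : ∀ u f x y z → vs± u f x y ≤ (vs± u f x z + vs± u f z y) + detour u x y z
vs±-triangle u f x y z = subst (_≤ bound) (sym (vs±≡ u f x y)) (⊔-lub forward backward)
  where
  open ≤-Reasoning
  bound : ℚ
  bound = (vs± u f x z + vs± u f z y) + detour u x y z
  dxz dzy dxy : ℚ
  dxz = dist u x z
  dzy = dist u z y
  dxy = dist u x y
  forward : (f x - f y) - dxy ≤ bound
  forward = begin
    (f x - f y) - dxy
      ≡⟨ solve 6 (λ a b c p q r → (a :- b) :- r
                                  := (((a :- c) :- p) :+ ((c :- b) :- q)) :+ ((p :+ q) :- r))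
               refl (f x) (f y) (f z) dxz dzy dxy ⟩
    (((f x - f z) - dxz) + ((f z - f y) - dzy)) + detour u x y z
      ≤⟨ +-monoˡ-≤ (detour u x y z) (+-mono-≤
           (subst ((f x - f z) - dxz ≤_) (sym (vs±≡ u f x z)) (p≤p⊔q _ ((f z - f x) - dxz)))
           (subst ((f z - f y) - dzy ≤_) (sym (vs±≡ u f z y)) (p≤p⊔q _ ((f y - f z) - dzy)))) ⟩
    (vs± u f x z + vs± u f z y) + detour u x y z ∎
  backward : (f y - f x) - dxy ≤ bound
  backward = begin
    (f y - f x) - dxy
      ≡⟨ solve 6 (λ a b c p q r → (b :- a) :- r
                                  := (((c :- a) :- p) :+ ((b :- c) :- q)) :+ ((p :+ q) :- r))
               refl (f x) (f y) (f z) dxz dzy dxy ⟩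
    (((f z - f x) - dxz) + ((f y - f z) - dzy)) + detour u x y z
      ≤⟨ +-monoˡ-≤ (detour u x y z) (+-mono-≤
           (subst ((f z - f x) - dxz ≤_) (sym (vs±≡ u f x z)) (p≤q⊔p ((f x - f z) - dxz) _))
           (subst ((f y - f z) - dzy ≤_) (sym (vs±≡ u f z y)) (p≤q⊔p ((f z - f y) - dzy) _))) ⟩
    (vs± u f x z + vs± u f z y) + detour u x y z ∎

violated-split : ∀ u f {x y z} → detour u x y z < vs± u f x y → 0ℚ < vs± u f x z ⊎ 0ℚ < vs± u f z y
violated-split u f {x} {y} {z} d<v with 0ℚ <? vs± u f x z | 0ℚ <? vs± u f z y
... | yes 0<xz | _        = inj₁ 0<xz
... | no _     | yes 0<zy = inj₂ 0<zy
... | no xz≯0  | no zy≯0  = ⊥-elim (<-irrefl refl (begin-strict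
  detour u x y z                                  <⟨ d<v ⟩
  vs± u f x y                                     ≤⟨ vs±-triangle u f x y z ⟩
  (vs± u f x z + vs± u f z y) + detour u x y z    ≤⟨ +-monoˡ-≤ (detour u x y z)
                                                        (+-mono-≤ (≮⇒≥ xz≯0) (≮⇒≥ zy≯0)) ⟩
  0ℚ + detour u x y z                             ≡⟨ +-identityˡ (detour u x y z) ⟩
  detour u x y z                                  ∎))
  where open ≤-Reasoning

injection⇒≤length : ∀ {A : Set} {k} {ys : List A} (g : Fin k → A) →
                    Injective _≡_ _≡_ g → (∀ i → g i ∈ ys) → k ≤ℕ length ys
injection⇒≤length {ys = ys} g g-inj g∈ys = Fin.injective⇒≤ index-injective
  where
  open ≡-Reasoning
  index-injective : Injective _≡_ _≡_ (λ i → index (g∈ys i))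
  index-injective {i} {j} eq = g-inj (begin
    g i                        ≡⟨ lookup-index (g∈ys i) ⟩
    lookup ys (index (g∈ys i)) ≡⟨ cong (lookup ys) eq ⟩
    lookup ys (index (g∈ys j)) ≡⟨ lookup-index (g∈ys j) ⟨
    g j                        ∎)

module _ {L y R : ℕ} (L≤y : L ≤ℕ y) (y≤R : y ≤ℕ R) where

  private
    ŷ : Fin (suc (R ∸ L))
    ŷ = fromℕ< (s≤s (ℕ.∸-monoˡ-≤ L y≤R))

  rangeWithout : Fin (R ∸ L) → ℕ
  rangeWithout i = L ℕ.+ toℕ (punchIn ŷ i)

  rangeWithout-injective : Injective _≡_ _≡_ rangeWithout
  rangeWithout-injective {i} {j} eq =
    Fin.punchIn-injective ŷ i j (Fin.toℕ-injective (ℕ.+-cancelˡ-≡ L _ _ eq))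

  rangeWithout≢ : ∀ i → rangeWithout i ≢ y
  rangeWithout≢ i eq = Fin.punchInᵢ≢i ŷ i (Fin.toℕ-injective (begin
    toℕ (punchIn ŷ i)  ≡⟨ ℕ.m+n∸m≡n L _ ⟨
    rangeWithout i ∸ L ≡⟨ cong (_∸ L) eq ⟩
    y ∸ L              ≡⟨ Fin.toℕ-fromℕ< _ ⟨
    toℕ ŷ              ∎))
    where open ≡-Reasoning

  rangeWithout-≥ : ∀ i → L ≤ℕ rangeWithout i
  rangeWithout-≥ i = ℕ.m≤m+n L _

  rangeWithout-≤ : ∀ i → rangeWithout i ≤ℕ R
  rangeWithout-≤ i = ℕ.≤-trans (ℕ.+-monoʳ-≤ L (Fin.toℕ≤pred[n] (punchIn ŷ i)))
                               (ℕ.≤-reflexive (ℕ.m+[n∸m]≡n (ℕ.≤-trans L≤y y≤R)))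

sortPair : ℕ → ℕ → ℕ × ℕ
sortPair i j with i ℕ.≤? j
... | yes _ = i , j
... | no  _ = j , i

sortPair-inversion : ∀ {a b c d} → sortPair a c ≡ sortPair b d → a ≡ b ⊎ (a ≡ d × c ≡ b)
sortPair-inversion {a} {b} {c} {d} eq with a ℕ.≤? c | b ℕ.≤? d | eq
... | yes _ | yes _ | refl = inj₁ refl
... | yes _ | no  _ | refl = inj₂ (refl , refl)
... | no  _ | yes _ | refl = inj₂ (refl , refl)
... | no  _ | no  _ | refl = inj₁ refl

ordered∈pairs : ∀ {n i j} → i <ℕ j → j <ℕ n → (i , j) ∈ pairs n
ordered∈pairs {n} {i} {j} i<j j<n =
  ∈-concat⁺′ (∈-map⁺ (_, j) (∈-upTo⁺ i<j)) (∈-map⁺ (λ b → map (_, b) (upTo b)) (∈-upTo⁺ j<n))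

module _ {_~_ : ℕ → ℕ → Set} (~-sym : ∀ {i j} → i ~ j → j ~ i) (~-irrefl : ∀ {i} → ¬ i ~ i)
         (_~?_ : ∀ i j → Dec (i ~ j)) where

  relatedPairs : ℕ → List (ℕ × ℕ)
  relatedPairs n = filter (λ p → proj₁ p ~? proj₂ p) (pairs n)

  sortPair∈relatedPairs : ∀ {n i j} → i ~ j → i <ℕ n → j <ℕ n → sortPair i j ∈ relatedPairs n
  sortPair∈relatedPairs {n} {i} {j} i~j i<n j<n with i ℕ.≤? j
  ... | yes i≤j = ∈-filter⁺ _ (ordered∈pairs (ℕ.≤∧≢⇒< i≤j (λ { refl → ~-irrefl i~j })) j<n) i~j
  ... | no  i≰j = ∈-filter⁺ _ (ordered∈pairs (ℕ.≰⇒> i≰j) i<n) (~-sym i~j)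

  relatedPairs-≥ : ∀ {n x y L R} → x <ℕ n → L ≤ℕ y → y ≤ℕ R → R <ℕ n →
                   (∀ z → L ≤ℕ z → z ≤ℕ R → z ≢ y → x ~ z ⊎ z ~ y) →
                   R ∸ L ≤ℕ length (relatedPairs n)
  relatedPairs-≥ {n} {x} {y} {L} {R} x<n L≤y y≤R R<n cover =
    injection⇒≤length pairOf pairOf-injective pairOf∈relatedPairs
    where
    partner : ℕ → ℕ
    partner z with x ~? z
    ... | yes _ = x
    ... | no  _ = y

    partner<n : ∀ z → partner z <ℕ n
    partner<n z with x ~? z
    ... | yes _ = x<n
    ... | no  _ = ℕ.≤-<-trans y≤R R<n

    related-partner : ∀ z → L ≤ℕ z → z ≤ℕ R → z ≢ y → z ~ partner z
    related-partner z L≤z z≤R z≢y with x ~? z | cover z L≤z z≤R z≢y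
    ... | yes x~z | _        = ~-sym x~z
    ... | no  x≁z | inj₁ x~z = ⊥-elim (x≁z x~z)
    ... | no  _   | inj₂ z~y = z~y

    ≡partner⇒≡x : ∀ {a} b → a ≢ y → a ≡ partner b → a ≡ x
    ≡partner⇒≡x b a≢y a≡ with x ~? b
    ... | yes _ = a≡
    ... | no  _ = ⊥-elim (a≢y a≡)

    point : Fin (R ∸ L) → ℕ
    point = rangeWithout L≤y y≤R

    pairOf : Fin (R ∸ L) → ℕ × ℕ
    pairOf i = sortPair (point i) (partner (point i))

    pairOf-injective : Injective _≡_ _≡_ pairOf
    pairOf-injective {i} {j} eq =
      rangeWithout-injective L≤y y≤R (same-point (sortPair-inversion eq))
      where
      -- Distinct points sharing a pair would be each other's partner, hence both x.
      same-point : point i ≡ point j ⊎ (point i ≡ partner (point j) × partner (point i) ≡ point j) →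
                   point i ≡ point j
      same-point (inj₁ eq)          = eq
      same-point (inj₂ (eq₁ , eq₂)) = trans (≡partner⇒≡x _ (rangeWithout≢ L≤y y≤R i) eq₁)
                                            (sym (≡partner⇒≡x _ (rangeWithout≢ L≤y y≤R j) (sym eq₂)))

    pairOf∈relatedPairs : ∀ i → pairOf i ∈ relatedPairs n
    pairOf∈relatedPairs i = sortPair∈relatedPairs
      (related-partner (point i) (rangeWithout-≥ L≤y y≤R i) (rangeWithout-≤ L≤y y≤R i)
                                 (rangeWithout≢ L≤y y≤R i))
      (ℕ.≤-<-trans (rangeWithout-≤ L≤y y≤R i) R<n)
      (partner<n (point i))

module _ {P : ℕ → Set} (P? : ∀ k → Dec (P k)) where

  firstFailureFrom : ∀ s n → (∀ k → s ≤ℕ k → k <ℕ n → P k)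
                           ⊎ ∃[ k ] (s ≤ℕ k × k <ℕ n × ¬ P k × (∀ j → s ≤ℕ j → j <ℕ k → P j))
  firstFailureFrom s zero = inj₁ (λ _ _ ())
  firstFailureFrom s (suc n) with firstFailureFrom s n
  ... | inj₂ (k , s≤k , k<n , ¬Pk , before) = inj₂ (k , s≤k , ℕ.m<n⇒m<1+n k<n , ¬Pk , before)
  ... | inj₁ below with P? n | s ℕ.≤? n
  ...   | yes Pn  | _       = inj₁ λ k s≤k k<1+n →
                                [ below k s≤k , (λ { refl → Pn }) ]′ (ℕ.m<1+n⇒m<n∨m≡n k<1+n)
  ...   | no  ¬Pn | yes s≤n = inj₂ (n , s≤n , ℕ.n<1+n n , ¬Pn , below)
  ...   | no  _   | no  s≰n = inj₁ λ k s≤k k<1+n → ⊥-elim (s≰n (ℕ.≤-trans s≤k (ℕ.≤-pred k<1+n)))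

  lastFailureBelow : ∀ s → (∀ k → k ≤ℕ s → P k)
                         ⊎ ∃[ k ] (k ≤ℕ s × ¬ P k × (∀ j → k <ℕ j → j ≤ℕ s → P j))
  lastFailureBelow s with P? s
  ... | no ¬Ps = inj₂ (s , ℕ.≤-refl , ¬Ps , λ j s<j j≤s → ⊥-elim (ℕ.<⇒≱ s<j j≤s))
  lastFailureBelow zero    | yes P0 = inj₁ λ { k z≤n → P0 }
  lastFailureBelow (suc s) | yes Ps with lastFailureBelow s
  ... | inj₁ below = inj₁ λ k k≤1+s →
          [ (λ k<1+s → below k (ℕ.≤-pred k<1+s)) , (λ { refl → Ps }) ]′ (ℕ.m≤n⇒m<n∨m≡n k≤1+s)
  ... | inj₂ (k , k≤s , ¬Pk , above) = inj₂ (k , ℕ.m≤n⇒m≤1+n k≤s , ¬Pk , λ j k<j j≤1+s →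
          [ (λ j<1+s → above j k<j (ℕ.≤-pred j<1+s)) , (λ { refl → Ps }) ]′ (ℕ.m≤n⇒m<n∨m≡n j≤1+s))

maxUpTo-≥ : ∀ u k {t} → t ≤ℕ k → u t ≤ maxUpTo k u
maxUpTo-≥ u zero    z≤n    = ≤-refl
maxUpTo-≥ u (suc k) t≤1+k with ℕ.m≤n⇒m<n∨m≡n t≤1+k
... | inj₁ t<1+k = ≤-trans (maxUpTo-≥ u k (ℕ.≤-pred t<1+k)) (p≤p⊔q (maxUpTo k u) (u (suc k)))
... | inj₂ refl  = p≤q⊔p (maxUpTo k u) (u (suc k))

uMax-≥ : ∀ n u {t} → t <ℕ n ∸ 1 → u t ≤ uMax n u
uMax-≥ n u {t} t<n-1 = maxUpTo-≥ u (n ∸ 2) (subst (t ≤ℕ_) (ℕ.∸-+-assoc n 1 1) (ℕ.∸-monoˡ-≤ 1 t<n-1))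

segSum-≤-uMax : ∀ n u {i j} → i ≤ℕ j → j <ℕ n → segSum u i j ≤ ℕ→ℚ (j ∸ i) * uMax n u
segSum-≤-uMax n u i≤j j<n =
  segSum-≤ u (uMax n u) i≤j (λ t _ t<j → uMax-≥ n u (ℕ.<-≤-trans t<j (ℕ.∸-monoˡ-≤ 1 j<n)))

twice-segSum-≤ : ∀ n u {i j} → i ≤ℕ j → j <ℕ n →
                 ℕ→ℚ 2 * segSum u i j ≤ (ℕ→ℚ 2 * uMax n u) * ℕ→ℚ (j ∸ i)
twice-segSum-≤ n u {i} {j} i≤j j<n = begin
  ℕ→ℚ 2 * segSum u i j             ≤⟨ *-monoˡ-≤-nonNeg (ℕ→ℚ 2) (segSum-≤-uMax n u i≤j j<n) ⟩
  ℕ→ℚ 2 * (ℕ→ℚ (j ∸ i) * uMax n u) ≡⟨ solve 3 (λ a b c → a :* (b :* c) := (a :* c) :* b) refl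
                                            (ℕ→ℚ 2) (ℕ→ℚ (j ∸ i)) (uMax n u) ⟩
  (ℕ→ℚ 2 * uMax n u) * ℕ→ℚ (j ∸ i) ∎
  where open ≤-Reasoning

divQ-≤ : ∀ {p q d} → 0ℚ < q → p ≤ q * d → divQ p q ≤ d
divQ-≤ {p} {q@(mkℚ ℤ.+[1+ _ ] _ _)} {d} _ p≤qd = begin
  p * 1/ q         ≡⟨ *-comm p (1/ q) ⟩
  1/ q * p         ≤⟨ *-monoˡ-≤-nonNeg (1/ q) p≤qd ⟩
  1/ q * (q * d)   ≡⟨ *-assoc (1/ q) q d ⟨
  (1/ q * q) * d   ≡⟨ cong (_* d) (*-inverseˡ q) ⟩
  1ℚ * d           ≡⟨ *-identityˡ d ⟩
  d                ∎
  where open ≤-Reasoning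
divQ-≤ {q = mkℚ (ℤ.+ 0)    _ _} (*<* 0<0) _ = ⊥-elim (ℤ.<-irrefl refl 0<0)
divQ-≤ {q = mkℚ ℤ.-[1+ _ ] _ _} (*<* ())   _

module ViolatedPair (n : ℕ) (f u : ℕ → ℚ) (u>0 : ∀ t → t <ℕ n ∸ 1 → 0ℚ < u t)
                    {x y : ℕ} (x<y : x <ℕ y) (y<n : y <ℕ n) (violated : 0ℚ < vs± u f x y) where

  v : ℚ
  v = vs± u f x y

  M : ℚ
  M = uMax n u

  K : ℕ
  K = countViolated (λ t → - u t) u f n

  Good : ℕ → Set
  Good z = detour u x y z < v

  good? : ∀ z → Dec (Good z)
  good? z = detour u x y z <? v

  private
    x≤y : x ≤ℕ y
    x≤y = ℕ.<⇒≤ x<y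
    y≤n-1 : y ≤ℕ n ∸ 1
    y≤n-1 = ℕ.∸-monoˡ-≤ 1 y<n
    n-1<n : n ∸ 1 <ℕ n
    n-1<n = ℕ.∸-monoʳ-< (s≤s z≤n) (ℕ.≤-<-trans z≤n y<n)

  good-between : ∀ {z} → x ≤ℕ z → z ≤ℕ y → Good z
  good-between x≤z z≤y = subst (_< v) (sym (detour-between u x≤z z≤y)) violated

  good-on : ∀ {L R} → (∀ z → L ≤ℕ z → z <ℕ x → Good z) → (∀ z → y <ℕ z → z ≤ℕ R → Good z) →
            ∀ z → L ≤ℕ z → z ≤ℕ R → Good z
  good-on left right z L≤z z≤R with x ℕ.≤? z | z ℕ.≤? y
  ... | no  x≰z | _       = left z L≤z (ℕ.≰⇒> x≰z)
  ... | yes x≤z | yes z≤y = good-between x≤z z≤y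
  ... | yes _   | no  z≰y = right z (ℕ.≰⇒> z≰y) z≤R

  count-≥ : ∀ {L R} → L ≤ℕ y → y ≤ℕ R → R <ℕ n →
            (∀ z → L ≤ℕ z → z <ℕ x → Good z) → (∀ z → y <ℕ z → z ≤ℕ R → Good z) → R ∸ L ≤ℕ K
  count-≥ L≤y y≤R R<n left right =
    relatedPairs-≥ violated-sym violated-irrefl (λ i j → 0ℚ <? vs± u f i j)
      (ℕ.<-trans x<y y<n) L≤y y≤R R<n
      (λ z L≤z z≤R _ → violated-split u f (good-on left right z L≤z z≤R))
    where
    violated-sym : ∀ {i j} → 0ℚ < vs± u f i j → 0ℚ < vs± u f j i
    violated-sym {i} {j} = subst (0ℚ <_) (vs-sym (λ t → - u t) u f i j)
    violated-irrefl : ∀ {i} → ¬ 0ℚ < vs± u f i i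
    violated-irrefl {i} 0<vs = <-irrefl (sym (vs±-refl u f i)) 0<vs

  M>0 : 0ℚ < M
  M>0 = <-≤-trans (u>0 0 0<n-1) (uMax-≥ n u 0<n-1)
    where
    0<n-1 : 0 <ℕ n ∸ 1
    0<n-1 = ℕ.<-≤-trans (ℕ.≤-<-trans z≤n x<y) y≤n-1

  Goal : Set
  Goal = divQ v (ℕ→ℚ 2 * M) ⊓ ℕ→ℚ (n ∸ 1) ≤ ℕ→ℚ K

  from-bad-point : ∀ d → d ≤ℕ K → v ≤ (ℕ→ℚ 2 * M) * ℕ→ℚ d → Goal
  from-bad-point d d≤K v≤ = begin
    divQ v (ℕ→ℚ 2 * M) ⊓ ℕ→ℚ (n ∸ 1) ≤⟨ p⊓q≤p (divQ v (ℕ→ℚ 2 * M)) (ℕ→ℚ (n ∸ 1)) ⟩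
    divQ v (ℕ→ℚ 2 * M)               ≤⟨ divQ-≤ 2M>0 v≤ ⟩
    ℕ→ℚ d                            ≤⟨ ℕ→ℚ-mono-≤ d≤K ⟩
    ℕ→ℚ K                            ∎
    where
    open ≤-Reasoning
    2M>0 : 0ℚ < ℕ→ℚ 2 * M
    2M>0 = subst (_< ℕ→ℚ 2 * M) (*-zeroʳ (ℕ→ℚ 2)) (*-monoʳ-<-pos (ℕ→ℚ 2) M>0)

  from-all-good : n ∸ 1 ≤ℕ K → Goal
  from-all-good n-1≤K = ≤-trans (p⊓q≤q (divQ v (ℕ→ℚ 2 * M)) (ℕ→ℚ (n ∸ 1))) (ℕ→ℚ-mono-≤ n-1≤K)

  bad-on-right : ∃[ k ] (suc y ≤ℕ k × k <ℕ n × ¬ Good k × (∀ j → suc y ≤ℕ j → j <ℕ k → Good j)) →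
                 Goal
  bad-on-right (suc r , s≤s y≤r , k<n , bad , before) =
    from-bad-point (suc r ∸ y) (ℕ.≤-trans (ℕ.∸-monoʳ-≤ (suc r) x<y) count) bound
    where
    count : r ∸ x ≤ℕ K
    count = count-≥ x≤y y≤r (ℕ.<-trans (ℕ.n<1+n r) k<n)
      (λ z x≤z z<x → ⊥-elim (ℕ.<⇒≱ z<x x≤z)) (λ z y<z z≤r → before z y<z (s≤s z≤r))
    bound : v ≤ (ℕ→ℚ 2 * M) * ℕ→ℚ (suc r ∸ y)
    bound = ≤-trans (subst (v ≤_) (detour-right u x≤y y≤k) (≮⇒≥ bad)) (twice-segSum-≤ n u y≤k k<n)
      where
      y≤k : y ≤ℕ suc r
      y≤k = ℕ.m≤n⇒m≤1+n y≤r

  bad-on-left : (∀ z → suc y ≤ℕ z → z <ℕ n → Good z) →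
                ∃[ k ] (k ≤ℕ x × ¬ Good k × (∀ j → k <ℕ j → j ≤ℕ x → Good j)) → Goal
  bad-on-left right (k , k≤x , bad , after) =
    from-bad-point (x ∸ k) (ℕ.≤-trans (ℕ.∸-monoˡ-≤ (suc k) (ℕ.≤-trans x<y y≤n-1)) count) bound
    where
    count : n ∸ 1 ∸ suc k ≤ℕ K
    count = count-≥ (ℕ.≤-<-trans k≤x x<y) y≤n-1 n-1<n
      (λ z k<z z<x → after z k<z (ℕ.<⇒≤ z<x))
      (λ z y<z z≤n-1 → right z y<z (ℕ.≤-<-trans z≤n-1 n-1<n))
    bound : v ≤ (ℕ→ℚ 2 * M) * ℕ→ℚ (x ∸ k)
    bound = ≤-trans (subst (v ≤_) (detour-left u k≤x x≤y) (≮⇒≥ bad))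
                    (twice-segSum-≤ n u k≤x (ℕ.<-trans x<y y<n))

  all-good : (∀ z → suc y ≤ℕ z → z <ℕ n → Good z) → (∀ z → z ≤ℕ x → Good z) → Goal
  all-good right left = from-all-good (count-≥ z≤n y≤n-1 n-1<n
    (λ z _ z<x → left z (ℕ.<⇒≤ z<x)) (λ z y<z z≤n-1 → right z y<z (ℕ.≤-<-trans z≤n-1 n-1<n)))

mainTheorem11 : (n : ℕ) (a b : ℚ) (f : ℕ → ℚ) (u : ℕ → ℚ)
    → (∀ x → x <ℕ n → (a ≤ f x) × (f x ≤ b))
    → (∀ t → t <ℕ n ∸ 1 → 0ℚ < u t)
    → (x y : ℕ) → x <ℕ y → y <ℕ n
    → 0ℚ < vs (λ t → - u t) u f x y
    → divQ (vs (λ t → - u t) u f x y) (ℕ→ℚ 2 * uMax n u) ⊓ ℕ→ℚ (n ∸ 1)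
    ≤ ℕ→ℚ (countViolated (λ t → - u t) u f n)
mainTheorem11 n a b f u _ u>0 x y x<y y<n violated =
  [ (λ right → [ all-good right , bad-on-left right ]′ (lastFailureBelow good? x))
  , bad-on-right
  ]′ (firstFailureFrom good? (suc y) n)
  where open ViolatedPair n f u u>0 x<y y<n violated
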